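{- Let $q\ge1$. Let $p_n$ (resp. $p'_n$) be the total number of occurrences of the letter $1$ (resp. of the letter $0$) over all $q$-decreasing binary words of length $n$. Then $$\sum_{n\ge0}p_nx^n=\frac{x\left(1-qx^q+qx^{q+1}-2x^{q+1}+x^{2q+2}\right)}{\left(1-2x+x^{q+2}\right)^2},\qquad \sum_{n\ge0}p'_nx^n=\frac{x\left(1-x^q\right)}{\left(1-2x+x^{q+2}\right)^2}.$$
   Context: A binary word is $q$-decreasing ($q\ge1$) if each of its maximal factors (maximal blocks of consecutive letters) of the form $0^a1^b$ with $a>0$ satisfies $q\cdot a>b$. -}

module Defs where

open import Data.Bool using (Bool; true; false; _∧_)
open import Data.Nat using (ℕ; zero; suc; _*_; _<ᵇ_; _∸_; _≟_)
open import Data.List using (List; []; _∷_; map; filter; _++_)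
open import Data.Nat.ListAction using (sum)
open import Relation.Binary.PropositionalEquality using (_≡_)
open import Data.Integer using (ℤ; +_; -_) renaming (_+_ to _+ℤ_; _*_ to _*ℤ_)
open import Relation.Nullary.Decidable using (does)
open import Data.Bool.Properties using (T?)

-- Binary words: lists over Bool, with  false = letter 0,  true = letter 1.

words : ℕ → List (List Bool)
words zero    = [] ∷ []
words (suc n) = map (false ∷_) (words n) ++ map (true ∷_) (words n)

ones : List Bool → ℕ
ones []          = 0
ones (true ∷ w)  = suc (ones w)
ones (false ∷ w) = ones w

zeros : List Bool → ℕ
zeros []          = 0
zeros (false ∷ w) = suc (zeros w)
zeros (true ∷ w)  = zeros w

-- The word is scanned left to right; every maximal
-- factor 0^a 1^b with a > 0 (a maximal run of 0's, followed by the maximal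
-- run of 1's right after it, b ≥ 0) must satisfy  b < q * a.
-- Leading 1's (not preceded by a 0) are unconstrained.
mutual
  qdec : ℕ → List Bool → Bool
  qdec q []          = true
  qdec q (true ∷ w)  = qdec q w
  qdec q (false ∷ w) = inZeros q 1 w

  -- inside the 0-run of a factor, a zeros read so far
  inZeros : ℕ → ℕ → List Bool → Bool
  inZeros q a []          = 0 <ᵇ q * a
  inZeros q a (false ∷ w) = inZeros q (suc a) w
  inZeros q a (true ∷ w)  = inOnes q a 1 w

  -- inside the 1-run of a factor 0^a1^b, b ones read so far
  inOnes : ℕ → ℕ → ℕ → List Bool → Bool
  inOnes q a b []          = b <ᵇ q * a
  inOnes q a b (true ∷ w)  = inOnes q a (suc b) w
  inOnes q a b (false ∷ w) = (b <ᵇ q * a) ∧ inZeros q 1 w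

qdecWords : ℕ → ℕ → List (List Bool)
qdecWords q n = filter (λ w → T? (qdec q w)) (words n)

p : ℕ → ℕ → ℕ
p q n = sum (map ones (qdecWords q n))

p′ : ℕ → ℕ → ℕ
p′ q n = sum (map zeros (qdecWords q n))

FPS : Set
FPS = ℕ → ℤ

ser : (ℕ → ℕ) → FPS
ser f n = + (f n)

mono : ℤ → ℕ → FPS
mono c k n with does (_≟_ k n)
... | true  = c
... | false = + 0

infixl 6 _⊕_
infixl 7 _⊛_
infix 4 _≐_

_⊕_ : FPS → FPS → FPS
(f ⊕ g) n = f n +ℤ g n

sumTo : ℕ → (ℕ → ℤ) → ℤ
sumTo zero    h = h 0
sumTo (suc m) h = sumTo m h +ℤ h (suc m)

_⊛_ : FPS → FPS → FPS
(f ⊛ g) n = sumTo n (λ k → f k *ℤ g (n ∸ k))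

_≐_ : FPS → FPS → Set
f ≐ g = ∀ n → f n ≡ g n

module Submission where

-- The test qdec of Defs is an automaton whose states remember the current
-- factor 0^a 1^b.  From the state 0^a 1^b the accepted continuations of
-- length m are 1^j v with j < q a - b and v q-decreasing and empty or starting
-- with 0, so their number (also when weighted by the number of zeros) is
-- c m - c (m - (q a - b)), where c counts q-decreasing words.  From the state
-- 0^a the count is K - T_a, where K = (1 + x C) / (1 - x) and
-- T_a = Σ_j x^j x^(q (a + j)) C, so that T_(a+1) = y T_a for y = x^q.  This
-- gives a finite linear system over ℤ[[x]] for C, K, T_1, T_2 and for the
-- analogous series Z counting zeros.  Eliminating with B = 1 - 2x + x² y
-- yields B C = 1 - x y, B K = 1 and B² Z = x (1 - y).  Finally
-- p_n = n c_n - z_n, i.e. P = θ C - Z for the derivation θ = x d/dx, and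
-- applying θ to B C = 1 - x y gives B² P.

open import Defs
open import Data.Nat using (ℕ; _≤_; _+_; _*_)
open import Data.Product using (_×_)
open import Data.Integer using (+_; -_)

open import Algebra.Bundles using (CommutativeRing; Ring)
import Algebra.Solver.Ring.AlmostCommutativeRing as ACR
open import Data.Bool using (Bool; true; false; _∧_; if_then_else_)
open import Data.Bool.Properties using (T?)
open import Data.Integer as ℤ using (ℤ; +0)
  renaming (_+_ to _+ℤ_; _*_ to _*ℤ_; _-_ to _-ℤ_)
import Data.Integer.Properties as ℤ
open import Data.Integer.Tactic.RingSolver using (solve-∀)
open import Algebra.Properties.CommutativeSemigroup ℤ.+-commutativeSemigroup
  using () renaming (interchange to +-interchange)
open import Data.List using (List; []; _∷_; length; map; filter; _++_)
open import Data.List.Properties using (map-++; map-∘)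
open import Data.Maybe using (Maybe; just; nothing)
open import Data.Nat using (zero; suc; _∸_; _<ᵇ_; z≤n; s≤s)
import Data.Nat.Properties as ℕ
open import Data.Nat.ListAction using (sum)
open import Data.Nat.ListAction.Properties using (sum-++)
open import Data.Nat.Tactic.RingSolver using () renaming (solve-∀ to ℕ-solve-∀)
open import Data.Product using (_,_)
open import Function using (_∘_)
open import Relation.Binary.PropositionalEquality
  using (_≡_; refl; sym; trans; cong; cong₂; module ≡-Reasoning)
open import Relation.Nullary using (yes; no)

-- An equation L ≈ R is derived from known equations lᵢ ≈ rᵢ by letting the
-- ring solver check a certificate L = R + Σ cᵢ (lᵢ - rᵢ); the lemmas below
-- then discard the null sum.
module Null {c ℓ} (R : Ring c ℓ) where
  open Ring R using (Carrier; _≈_; 0#; +-cong; *-cong; -‿cong; +-identityˡ; +-identityʳ; zeroʳ)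
    renaming (_+_ to _+ᴿ_; _*_ to _*ᴿ_; -_ to -ᴿ_; refl to ≈-refl; trans to ≈-trans)
  open import Algebra.Properties.Ring R using (-0#≈0#)
  open import Algebra.Properties.Group (Ring.+-group R) using (x≈y⇒x∙y⁻¹≈ε; x∙y⁻¹≈ε⇒x≈y)

  Null : Carrier → Set ℓ
  Null x = x ≈ 0#

  null-+ : ∀ {x y} → Null x → Null y → Null (x +ᴿ y)
  null-+ x≈0 y≈0 = ≈-trans (+-cong x≈0 y≈0) (+-identityˡ 0#)

  null-*ˡ : ∀ r {x} → Null x → Null (r *ᴿ x)
  null-*ˡ r x≈0 = ≈-trans (*-cong ≈-refl x≈0) (zeroʳ r)

  null-‿ : ∀ {x} → Null x → Null (-ᴿ x)
  null-‿ x≈0 = ≈-trans (-‿cong x≈0) -0#≈0#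

  ≈⇒null-diff : ∀ {x y} → x ≈ y → Null (x +ᴿ -ᴿ y)
  ≈⇒null-diff = x≈y⇒x∙y⁻¹≈ε

  null-diff⇒≈ : ∀ {x y} → Null (x +ᴿ -ᴿ y) → x ≈ y
  null-diff⇒≈ = x∙y⁻¹≈ε⇒x≈y _ _

  ≈+null⇒≈ : ∀ {x y z} → x ≈ y +ᴿ z → Null z → x ≈ y
  ≈+null⇒≈ {y = y} x≈y+z z≈0 = ≈-trans x≈y+z (≈-trans (+-cong ≈-refl z≈0) (+-identityʳ y))

-- Formal power series

sumTo-cong : ∀ n {f g : ℕ → ℤ} → (∀ k → k ≤ n → f k ≡ g k) → sumTo n f ≡ sumTo n g
sumTo-cong zero    f≗g = f≗g 0 z≤n
sumTo-cong (suc n) f≗g =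
  cong₂ _+ℤ_ (sumTo-cong n (λ k k≤n → f≗g k (ℕ.m≤n⇒m≤1+n k≤n))) (f≗g (suc n) ℕ.≤-refl)

sumTo-ext : ∀ n {f g : ℕ → ℤ} → (∀ k → f k ≡ g k) → sumTo n f ≡ sumTo n g
sumTo-ext n f≗g = sumTo-cong n (λ k _ → f≗g k)

sumTo-+ : ∀ n (f g : ℕ → ℤ) → sumTo n (λ k → f k +ℤ g k) ≡ sumTo n f +ℤ sumTo n g
sumTo-+ zero    f g = refl
sumTo-+ (suc n) f g = begin
  sumTo n (λ k → f k +ℤ g k) +ℤ (f (suc n) +ℤ g (suc n))
    ≡⟨ cong (_+ℤ (f (suc n) +ℤ g (suc n))) (sumTo-+ n f g) ⟩
  (sumTo n f +ℤ sumTo n g) +ℤ (f (suc n) +ℤ g (suc n))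
    ≡⟨ +-interchange (sumTo n f) (sumTo n g) (f (suc n)) (g (suc n)) ⟩
  (sumTo n f +ℤ f (suc n)) +ℤ (sumTo n g +ℤ g (suc n)) ∎
  where open ≡-Reasoning

sumTo-*ˡ : ∀ n c (f : ℕ → ℤ) → c *ℤ sumTo n f ≡ sumTo n (λ k → c *ℤ f k)
sumTo-*ˡ zero    c f = refl
sumTo-*ˡ (suc n) c f =
  trans (ℤ.*-distribˡ-+ c (sumTo n f) (f (suc n))) (cong (_+ℤ c *ℤ f (suc n)) (sumTo-*ˡ n c f))

sumTo-*ʳ : ∀ n c (f : ℕ → ℤ) → sumTo n f *ℤ c ≡ sumTo n (λ k → f k *ℤ c)
sumTo-*ʳ n c f = begin
  sumTo n f *ℤ c               ≡⟨ ℤ.*-comm (sumTo n f) c ⟩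
  c *ℤ sumTo n f               ≡⟨ sumTo-*ˡ n c f ⟩
  sumTo n (λ k → c *ℤ f k)     ≡⟨ sumTo-ext n (λ k → ℤ.*-comm c (f k)) ⟩
  sumTo n (λ k → f k *ℤ c)     ∎
  where open ≡-Reasoning

sumTo-zero : ∀ n → sumTo n (λ _ → +0) ≡ +0
sumTo-zero zero    = refl
sumTo-zero (suc n) = cong (_+ℤ +0) (sumTo-zero n)

sumTo-suc : ∀ n (f : ℕ → ℤ) → sumTo (suc n) f ≡ f 0 +ℤ sumTo n (f ∘ suc)
sumTo-suc zero    f = refl
sumTo-suc (suc n) f = trans (cong (_+ℤ f (suc (suc n))) (sumTo-suc n f))
                            (ℤ.+-assoc (f 0) (sumTo n (f ∘ suc)) (f (suc (suc n))))

sumTo-reverse : ∀ n (f : ℕ → ℤ) → sumTo n f ≡ sumTo n (λ k → f (n ∸ k))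
sumTo-reverse zero    f = refl
sumTo-reverse (suc n) f = begin
  sumTo n f +ℤ f (suc n)                   ≡⟨ ℤ.+-comm (sumTo n f) (f (suc n)) ⟩
  f (suc n) +ℤ sumTo n f                   ≡⟨ cong (f (suc n) +ℤ_) (sumTo-reverse n f) ⟩
  f (suc n) +ℤ sumTo n (λ k → f (n ∸ k))   ≡⟨ sym (sumTo-suc n (λ k → f (suc n ∸ k))) ⟩
  sumTo (suc n) (λ k → f (suc n ∸ k))      ∎
  where open ≡-Reasoning

sumTo-triangle : ∀ n (G : ℕ → ℕ → ℤ) →
  sumTo n (λ k → sumTo k (λ i → G i (k ∸ i))) ≡ sumTo n (λ i → sumTo (n ∸ i) (G i))
sumTo-triangle zero    G = refl
sumTo-triangle (suc n) G = begin
  sumTo n (λ k → sumTo k (λ i → G i (k ∸ i))) +ℤ sumTo (suc n) (λ i → G i (suc n ∸ i))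
    ≡⟨ cong (_+ℤ sumTo (suc n) (λ i → G i (suc n ∸ i))) (sumTo-triangle n G) ⟩
  rows +ℤ (sumTo n (λ i → G i (suc n ∸ i)) +ℤ G (suc n) (n ∸ n))
    ≡⟨ sym (ℤ.+-assoc rows _ _) ⟩
  (rows +ℤ sumTo n (λ i → G i (suc n ∸ i))) +ℤ G (suc n) (n ∸ n)
    ≡⟨ cong (_+ℤ G (suc n) (n ∸ n)) (sym (sumTo-+ n _ _)) ⟩
  sumTo n (λ i → sumTo (n ∸ i) (G i) +ℤ G i (suc n ∸ i)) +ℤ G (suc n) (n ∸ n)
    ≡⟨ cong₂ _+ℤ_ (sumTo-cong n extend-row) (single-term (n ∸ n) (ℕ.n∸n≡0 n)) ⟩
  sumTo n (λ i → sumTo (suc n ∸ i) (G i)) +ℤ sumTo (suc n ∸ suc n) (G (suc n)) ∎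
  where
  open ≡-Reasoning
  rows = sumTo n (λ i → sumTo (n ∸ i) (G i))
  extend-row : ∀ i → i ≤ n → sumTo (n ∸ i) (G i) +ℤ G i (suc n ∸ i) ≡ sumTo (suc n ∸ i) (G i)
  extend-row i i≤n rewrite ℕ.+-∸-assoc 1 i≤n = refl
  single-term : ∀ m → m ≡ 0 → G (suc n) m ≡ sumTo m (G (suc n))
  single-term .0 refl = refl

𝟘 𝟙 : FPS
𝟘 _ = +0
𝟙 = mono (+ 1) 0

infix 8 ⊝_

⊝_ : FPS → FPS
(⊝ f) n = - f n

mono-0-⊛ : ∀ a f → mono a 0 ⊛ f ≐ λ n → a *ℤ f n
mono-0-⊛ a f zero    = refl
mono-0-⊛ a f (suc n) = begin
  sumTo (suc n) (λ k → mono a 0 k *ℤ f (suc n ∸ k))  ≡⟨ sumTo-suc n _ ⟩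
  a *ℤ f (suc n) +ℤ sumTo n (λ _ → +0)               ≡⟨ cong (a *ℤ f (suc n) +ℤ_) (sumTo-zero n) ⟩
  a *ℤ f (suc n) +ℤ +0                                ≡⟨ ℤ.+-identityʳ _ ⟩
  a *ℤ f (suc n)                                      ∎
  where open ≡-Reasoning

mono-*ˡ : ∀ a b k n → mono (a *ℤ b) k n ≡ a *ℤ mono b k n
mono-*ˡ a b zero    zero    = refl
mono-*ˡ a b zero    (suc n) = sym (ℤ.*-zeroʳ a)
mono-*ˡ a b (suc k) zero    = sym (ℤ.*-zeroʳ a)
mono-*ˡ a b (suc k) (suc n) = mono-*ˡ a b k n

⊛-identityˡ : ∀ f → 𝟙 ⊛ f ≐ f
⊛-identityˡ f n = trans (mono-0-⊛ (+ 1) f n) (ℤ.*-identityˡ (f n))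

⊛-comm : ∀ f g → f ⊛ g ≐ g ⊛ f
⊛-comm f g n = begin
  sumTo n (λ k → f k *ℤ g (n ∸ k))                    ≡⟨ sumTo-reverse n _ ⟩
  sumTo n (λ k → f (n ∸ k) *ℤ g (n ∸ (n ∸ k)))        ≡⟨ sumTo-cong n swap ⟩
  sumTo n (λ k → g k *ℤ f (n ∸ k))                    ∎
  where
  open ≡-Reasoning
  swap : ∀ k → k ≤ n → f (n ∸ k) *ℤ g (n ∸ (n ∸ k)) ≡ g k *ℤ f (n ∸ k)
  swap k k≤n = trans (cong (λ m → f (n ∸ k) *ℤ g m) (ℕ.m∸[m∸n]≡n k≤n)) (ℤ.*-comm (f (n ∸ k)) (g k))

⊛-distribˡ : ∀ f g h → f ⊛ (g ⊕ h) ≐ f ⊛ g ⊕ f ⊛ h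
⊛-distribˡ f g h n =
  trans (sumTo-ext n (λ k → ℤ.*-distribˡ-+ (f k) (g (n ∸ k)) (h (n ∸ k)))) (sumTo-+ n _ _)

⊛-cong : ∀ {f f′ g g′} → f ≐ f′ → g ≐ g′ → f ⊛ g ≐ f′ ⊛ g′
⊛-cong f≐f′ g≐g′ n = sumTo-ext n (λ k → cong₂ _*ℤ_ (f≐f′ k) (g≐g′ (n ∸ k)))

⊛-assoc : ∀ f g h → (f ⊛ g) ⊛ h ≐ f ⊛ (g ⊛ h)
⊛-assoc f g h n = begin
  sumTo n (λ k → sumTo k (λ i → f i *ℤ g (k ∸ i)) *ℤ h (n ∸ k))
    ≡⟨ sumTo-ext n (λ k → sumTo-*ʳ k (h (n ∸ k)) _) ⟩
  sumTo n (λ k → sumTo k (λ i → (f i *ℤ g (k ∸ i)) *ℤ h (n ∸ k)))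
    ≡⟨ sumTo-cong n (λ k _ → sumTo-cong k (reindex k)) ⟩
  sumTo n (λ k → sumTo k (λ i → G i (k ∸ i)))
    ≡⟨ sumTo-triangle n G ⟩
  sumTo n (λ i → sumTo (n ∸ i) (G i))
    ≡⟨ sumTo-ext n (λ i → sym (sumTo-*ˡ (n ∸ i) (f i) _)) ⟩
  sumTo n (λ i → f i *ℤ sumTo (n ∸ i) (λ j → g j *ℤ h (n ∸ i ∸ j))) ∎
  where
  open ≡-Reasoning
  G : ℕ → ℕ → ℤ
  G i j = f i *ℤ (g j *ℤ h (n ∸ i ∸ j))
  reindex : ∀ k i → i ≤ k → (f i *ℤ g (k ∸ i)) *ℤ h (n ∸ k) ≡ G i (k ∸ i)
  reindex k i i≤k = trans (ℤ.*-assoc (f i) (g (k ∸ i)) (h (n ∸ k)))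
    (cong (λ m → f i *ℤ (g (k ∸ i) *ℤ h m))
          (trans (cong (n ∸_) (sym (ℕ.m+[n∸m]≡n i≤k))) (sym (ℕ.∸-+-assoc n i (k ∸ i)))))

-- A record rather than ≐ itself, so that both series stay inferable from the
-- type of an equation.
infix 4 _≈_

record _≈_ (f g : FPS) : Set where
  constructor coeffwise
  field coeff : f ≐ g
open _≈_ public

module _ where
  open import Algebra.Structures {A = FPS} _≈_
  open import Relation.Binary.Structures using (IsEquivalence)

  ≈-isEquivalence : IsEquivalence _≈_
  ≈-isEquivalence = record
    { refl  = coeffwise (λ _ → refl)
    ; sym   = λ f≈g → coeffwise (λ n → sym (coeff f≈g n))
    ; trans = λ f≈g g≈h → coeffwise (λ n → trans (coeff f≈g n) (coeff g≈h n))
    }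

  ⊕-⊛-isCommutativeRing : IsCommutativeRing _⊕_ _⊛_ ⊝_ 𝟘 𝟙
  ⊕-⊛-isCommutativeRing = record
    { isRing = record
      { +-isAbelianGroup = record
        { isGroup = record
          { isMonoid = record
            { isSemigroup = record
              { isMagma = record
                { isEquivalence = ≈-isEquivalence
                ; ∙-cong = λ f≈f′ g≈g′ → coeffwise (λ n → cong₂ _+ℤ_ (coeff f≈f′ n) (coeff g≈g′ n))
                }
              ; assoc = λ f g h → coeffwise (λ n → ℤ.+-assoc (f n) (g n) (h n))
              }
            ; identity = (λ f → coeffwise (λ n → ℤ.+-identityˡ (f n)))
                       , (λ f → coeffwise (λ n → ℤ.+-identityʳ (f n)))
            }
          ; inverse = (λ f → coeffwise (λ n → ℤ.+-inverseˡ (f n)))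
                    , (λ f → coeffwise (λ n → ℤ.+-inverseʳ (f n)))
          ; ⁻¹-cong = λ f≈g → coeffwise (λ n → cong -_ (coeff f≈g n))
          }
        ; comm = λ f g → coeffwise (λ n → ℤ.+-comm (f n) (g n))
        }
      ; *-cong = λ f≈f′ g≈g′ → coeffwise (⊛-cong (coeff f≈f′) (coeff g≈g′))
      ; *-assoc = λ f g h → coeffwise (⊛-assoc f g h)
      ; *-identity = (λ f → coeffwise (⊛-identityˡ f))
                   , (λ f → coeffwise (λ n → trans (⊛-comm f 𝟙 n) (⊛-identityˡ f n)))
      ; distrib = (λ f g h → coeffwise (⊛-distribˡ f g h))
                , (λ f g h → coeffwise (λ n → trans (⊛-comm (g ⊕ h) f n)
                     (trans (⊛-distribˡ f g h n) (cong₂ _+ℤ_ (⊛-comm f g n) (⊛-comm f h n)))))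
      }
    ; *-comm = λ f g → coeffwise (⊛-comm f g)
    }

⊕-⊛-commutativeRing : CommutativeRing _ _
⊕-⊛-commutativeRing = record { isCommutativeRing = ⊕-⊛-isCommutativeRing }

-- The solver works with integer coefficients, embedded as constant series, so
-- that normal forms have literal coefficients and compare by refl.
module FPSSolver where
  const-homomorphism : ℤ.+-*-rawRing ACR.-Raw-AlmostCommutative⟶
                       ACR.fromCommutativeRing ⊕-⊛-commutativeRing
  const-homomorphism = record
    { ⟦_⟧    = λ a → mono a 0
    ; +-homo = λ a b → coeffwise (λ { zero → refl ; (suc n) → refl })
    ; *-homo = λ a b → coeffwise (λ n → sym (trans (mono-0-⊛ a (mono b 0) n) (sym (mono-*ˡ a b 0 n))))
    ; -‿homo = λ a → coeffwise (λ { zero → refl ; (suc n) → refl })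
    ; 0-homo = coeffwise (λ { zero → refl ; (suc n) → refl })
    ; 1-homo = coeffwise (λ _ → refl)
    }

  const-≟ : ∀ a b → Maybe (mono a 0 ≈ mono b 0)
  const-≟ a b with a ℤ.≟ b
  ... | yes refl = just (coeffwise (λ _ → refl))
  ... | no _     = nothing

  open import Algebra.Solver.Ring ℤ.+-*-rawRing (ACR.fromCommutativeRing ⊕-⊛-commutativeRing)
    const-homomorphism
    const-≟ public

shift : ℕ → FPS → FPS
shift zero    f n       = f n
shift (suc k) f zero    = +0
shift (suc k) f (suc n) = shift k f n

shift-cong : ∀ k {f g} → f ≐ g → shift k f ≐ shift k g
shift-cong zero    f≐g n       = f≐g n
shift-cong (suc k) f≐g zero    = refl
shift-cong (suc k) f≐g (suc n) = shift-cong k f≐g n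

shift-index : ∀ {i j} → i ≡ j → ∀ f → shift i f ≐ shift j f
shift-index i≡j f n = cong (λ m → shift m f n) i≡j

shift-⊕ : ∀ k f g → shift k (f ⊕ g) ≐ shift k f ⊕ shift k g
shift-⊕ zero    f g n       = refl
shift-⊕ (suc k) f g zero    = refl
shift-⊕ (suc k) f g (suc n) = shift-⊕ k f g n

shift-shift : ∀ j k f → shift j (shift k f) ≐ shift (k + j) f
shift-shift zero    k f n       = cong (λ i → shift i f n) (sym (ℕ.+-identityʳ k))
shift-shift (suc j) k f zero    = cong (λ i → shift i f 0) (sym (ℕ.+-suc k j))
shift-shift (suc j) k f (suc n) = trans (shift-shift j k f n) (cong (λ i → shift i f (suc n)) (sym (ℕ.+-suc k j)))

shift-comm : ∀ i j f → shift i (shift j f) ≐ shift j (shift i f)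
shift-comm i j f n = trans (shift-shift i j f n) (trans (shift-index (ℕ.+-comm j i) f n) (sym (shift-shift j i f n)))

mono-⊛ : ∀ a k f → mono a k ⊛ f ≐ λ n → a *ℤ shift k f n
mono-⊛ a zero    f n       = mono-0-⊛ a f n
mono-⊛ a (suc k) f zero    = sym (ℤ.*-zeroʳ a)
mono-⊛ a (suc k) f (suc n) = begin
  sumTo (suc n) (λ i → mono a (suc k) i *ℤ f (suc n ∸ i))  ≡⟨ sumTo-suc n _ ⟩
  +0 *ℤ f (suc n) +ℤ (mono a k ⊛ f) n                      ≡⟨ ℤ.+-identityˡ _ ⟩
  (mono a k ⊛ f) n                                          ≡⟨ mono-⊛ a k f n ⟩
  a *ℤ shift k f n                                          ∎
  where open ≡-Reasoning

x^-⊛ : ∀ k f → mono (+ 1) k ⊛ f ≐ shift k f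
x^-⊛ k f n = trans (mono-⊛ (+ 1) k f n) (ℤ.*-identityˡ _)

≐⊕shift⇒≈⊕x⊛ : ∀ {f} a g → f ≐ a ⊕ shift 1 g → f ≈ a ⊕ mono (+ 1) 1 ⊛ g
≐⊕shift⇒≈⊕x⊛ a g f≐ = coeffwise λ n → trans (f≐ n) (cong (a n +ℤ_) (sym (x^-⊛ 1 g n)))

≐shift⇒≈x⊛ : ∀ {f} g → f ≐ shift 1 g → f ≈ mono (+ 1) 1 ⊛ g
≐shift⇒≈x⊛ g f≐ = coeffwise λ n → trans (f≐ n) (sym (x^-⊛ 1 g n))

shift-mono : ∀ j a k → shift j (mono a k) ≐ mono a (j + k)
shift-mono zero    a k n       = refl
shift-mono (suc j) a k zero    = refl
shift-mono (suc j) a k (suc n) = shift-mono j a k n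

mono-⊛-mono : ∀ a b k j → mono a k ⊛ mono b j ≈ mono (a *ℤ b) (k + j)
mono-⊛-mono a b k j = coeffwise λ n → begin
  (mono a k ⊛ mono b j) n       ≡⟨ mono-⊛ a k (mono b j) n ⟩
  a *ℤ shift k (mono b j) n     ≡⟨ cong (a *ℤ_) (shift-mono k b j n) ⟩
  a *ℤ mono b (k + j) n         ≡⟨ sym (mono-*ˡ a b (k + j) n) ⟩
  mono (a *ℤ b) (k + j) n       ∎
  where open ≡-Reasoning

mono-+ : ∀ a b k → mono (a +ℤ b) k ≈ mono a k ⊕ mono b k
mono-+ a b zero    = coeffwise λ { zero → refl ; (suc n) → refl }
mono-+ a b (suc k) = coeffwise λ { zero → refl ; (suc n) → coeff (mono-+ a b k) n }

mono-neg : ∀ a k → mono (- a) k ≈ ⊝ mono a k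
mono-neg a zero    = coeffwise λ { zero → refl ; (suc n) → refl }
mono-neg a (suc k) = coeffwise λ { zero → refl ; (suc n) → coeff (mono-neg a k) n }

mono-coeff : ∀ k {a b} → a ≡ b → mono a k ≈ mono b k
mono-coeff k refl = coeffwise (λ _ → refl)

mono-degree : ∀ a {i j} → i ≡ j → mono a i ≈ mono a j
mono-degree a refl = coeffwise (λ _ → refl)

x^⊛x^ : ∀ i j → mono (+ 1) i ⊛ mono (+ 1) j ≈ mono (+ 1) (i + j)
x^⊛x^ = mono-⊛-mono (+ 1) (+ 1)

const⊛x^ : ∀ a k → mono a 0 ⊛ mono (+ 1) k ≈ mono a k
const⊛x^ a k = coeffwise λ n → trans (coeff (mono-⊛-mono a (+ 1) 0 k) n) (coeff (mono-coeff k (ℤ.*-identityʳ a)) n)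

runningSum : ℤ → FPS → FPS
runningSum a f zero    = a
runningSum a f (suc n) = runningSum a f n +ℤ f n

runningSum-unfold : ∀ a f → runningSum a f ≐ mono a 0 ⊕ shift 1 (runningSum a f ⊕ f)
runningSum-unfold a f zero    = sym (ℤ.+-identityʳ a)
runningSum-unfold a f (suc n) = sym (ℤ.+-identityˡ _)

-- tails F a = Σ_j x^j F (a + j)
tails : (ℕ → FPS) → ℕ → FPS
tails F a zero    = F a 0
tails F a (suc n) = F a (suc n) +ℤ tails F (suc a) n

tails-unfold : ∀ F a → tails F a ≐ F a ⊕ shift 1 (tails F (suc a))
tails-unfold F a zero    = sym (ℤ.+-identityʳ (F a 0))
tails-unfold F a (suc n) = refl

tails-shift : ∀ j F → (∀ a → F (suc a) ≐ shift j (F a)) → ∀ a → tails F (suc a) ≐ shift j (tails F a)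
tails-shift j F F-shift a n = begin
  tails F (suc a) n                                      ≡⟨ unfolded n ⟩
  shift j (F a) n +ℤ shift (suc j) (tails F (suc a)) n   ≡⟨ cong (shift j (F a) n +ℤ_) (sym (shift-shift j 1 _ n)) ⟩
  shift j (F a) n +ℤ shift j (shift 1 (tails F (suc a))) n ≡⟨ sym (shift-⊕ j (F a) _ n) ⟩
  shift j (F a ⊕ shift 1 (tails F (suc a))) n            ≡⟨ sym (shift-cong j (tails-unfold F a) n) ⟩
  shift j (tails F a) n                                  ∎
  where
  open ≡-Reasoning
  unfolded : ∀ n → tails F (suc a) n ≡ shift j (F a) n +ℤ shift (suc j) (tails F (suc a)) n
  unfolded zero    = trans (F-shift a 0) (sym (ℤ.+-identityʳ _))
  unfolded (suc n) = cong₂ _+ℤ_ (F-shift a (suc n)) (tails-shift j F F-shift (suc a) n)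

θ : FPS → FPS
θ f n = + n *ℤ f n

θ-cong : ∀ {f g} → f ≈ g → θ f ≈ θ g
θ-cong f≈g = coeffwise λ n → cong (+ n *ℤ_) (coeff f≈g n)

θ-⊕ : ∀ f g → θ (f ⊕ g) ≈ θ f ⊕ θ g
θ-⊕ f g = coeffwise λ n → ℤ.*-distribˡ-+ (+ n) (f n) (g n)

θ-⊝ : ∀ f → θ (⊝ f) ≈ ⊝ θ f
θ-⊝ f = coeffwise λ n → sym (ℤ.neg-distribʳ-* (+ n) (f n))

θ-mono : ∀ a k → θ (mono a k) ≈ mono (+ k *ℤ a) k
θ-mono a k = coeffwise λ n → sym (trans (mono-*ˡ (+ k) a k n) (same-degree k n))
  where
  same-degree : ∀ k n → + k *ℤ mono a k n ≡ + n *ℤ mono a k n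
  same-degree zero    zero    = refl
  same-degree zero    (suc n) = trans (ℤ.*-zeroʳ (+ 0)) (sym (ℤ.*-zeroʳ (+ suc n)))
  same-degree (suc k) zero    = trans (ℤ.*-zeroʳ (+ suc k)) (sym (ℤ.*-zeroʳ (+ 0)))
  same-degree (suc k) (suc n) = begin
    (+ 1 +ℤ + k) *ℤ m           ≡⟨ ℤ.*-distribʳ-+ m (+ 1) (+ k) ⟩
    + 1 *ℤ m +ℤ + k *ℤ m        ≡⟨ cong (+ 1 *ℤ m +ℤ_) (same-degree k n) ⟩
    + 1 *ℤ m +ℤ + n *ℤ m        ≡⟨ sym (ℤ.*-distribʳ-+ m (+ 1) (+ n)) ⟩
    (+ 1 +ℤ + n) *ℤ m           ∎
    where
    open ≡-Reasoning
    m = mono a k n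

θ-⊛ : ∀ f g → θ (f ⊛ g) ≈ θ f ⊛ g ⊕ f ⊛ θ g
θ-⊛ f g = coeffwise λ n → begin
  + n *ℤ sumTo n (λ k → f k *ℤ g (n ∸ k))
    ≡⟨ sumTo-*ˡ n (+ n) _ ⟩
  sumTo n (λ k → + n *ℤ (f k *ℤ g (n ∸ k)))
    ≡⟨ sumTo-cong n (λ k k≤n → trans (cong (λ m → + m *ℤ (f k *ℤ g (n ∸ k))) (sym (ℕ.m+[n∸m]≡n k≤n)))
                                     (leibniz (+ k) (+ (n ∸ k)) (f k) (g (n ∸ k)))) ⟩
  sumTo n (λ k → (+ k *ℤ f k) *ℤ g (n ∸ k) +ℤ f k *ℤ (+ (n ∸ k) *ℤ g (n ∸ k)))
    ≡⟨ sumTo-+ n _ _ ⟩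
  (θ f ⊛ g) n +ℤ (f ⊛ θ g) n ∎
  where
  open ≡-Reasoning
  leibniz : ∀ i j a b → (i +ℤ j) *ℤ (a *ℤ b) ≡ (i *ℤ a) *ℤ b +ℤ a *ℤ (j *ℤ b)
  leibniz = solve-∀

⊛≈𝟘⇒≈𝟘 : ∀ f g → f 0 ≡ + 1 → f ⊛ g ≈ 𝟘 → g ≈ 𝟘
⊛≈𝟘⇒≈𝟘 f g f₀≡1 fg≈𝟘 = coeffwise λ n → vanish n n ℕ.≤-refl
  where
  vanish : ∀ n m → m ≤ n → g m ≡ +0
  vanish n zero _ = begin
    g 0                ≡⟨ sym (ℤ.*-identityˡ (g 0)) ⟩
    + 1 *ℤ g 0         ≡⟨ cong (_*ℤ g 0) (sym f₀≡1) ⟩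
    f 0 *ℤ g 0         ≡⟨ coeff fg≈𝟘 0 ⟩
    +0                 ∎
    where open ≡-Reasoning
  vanish (suc n) (suc m) (s≤s m≤n) = begin
    g (suc m)                                              ≡⟨ sym (trans (ℤ.+-identityʳ _) (ℤ.*-identityˡ _)) ⟩
    + 1 *ℤ g (suc m) +ℤ +0                                 ≡⟨ cong₂ _+ℤ_ (cong (_*ℤ g (suc m)) (sym f₀≡1)) (sym (sumTo-zero m)) ⟩
    f 0 *ℤ g (suc m) +ℤ sumTo m (λ _ → +0)                 ≡⟨ cong (f 0 *ℤ g (suc m) +ℤ_) (sumTo-cong m lower-terms) ⟩
    f 0 *ℤ g (suc m) +ℤ sumTo m (λ k → f (suc k) *ℤ g (m ∸ k)) ≡⟨ sym (sumTo-suc m _) ⟩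
    (f ⊛ g) (suc m)                                        ≡⟨ coeff fg≈𝟘 (suc m) ⟩
    +0                                                     ∎
    where
    open ≡-Reasoning
    lower-terms : ∀ k → k ≤ m → +0 ≡ f (suc k) *ℤ g (m ∸ k)
    lower-terms k _ = sym (trans (cong (f (suc k) *ℤ_) (vanish n (m ∸ k) (ℕ.≤-trans (ℕ.m∸n≤m m k) m≤n)))
                                 (ℤ.*-zeroʳ (f (suc k))))

-- Binary words

wordSum : ℕ → (List Bool → ℤ) → ℤ
wordSum zero    g = g []
wordSum (suc n) g = wordSum n (g ∘ (false ∷_)) +ℤ wordSum n (g ∘ (true ∷_))

wordSum-cong : ∀ n {g h : List Bool → ℤ} → (∀ w → length w ≡ n → g w ≡ h w) → wordSum n g ≡ wordSum n h
wordSum-cong zero    g≗h = g≗h [] refl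
wordSum-cong (suc n) g≗h = cong₂ _+ℤ_ (wordSum-cong n (λ w |w|≡n → g≗h (false ∷ w) (cong suc |w|≡n)))
                                      (wordSum-cong n (λ w |w|≡n → g≗h (true ∷ w) (cong suc |w|≡n)))

wordSum-ext : ∀ n {g h : List Bool → ℤ} → (∀ w → g w ≡ h w) → wordSum n g ≡ wordSum n h
wordSum-ext n g≗h = wordSum-cong n (λ w _ → g≗h w)

wordSum-+ : ∀ n (g h : List Bool → ℤ) → wordSum n (λ w → g w +ℤ h w) ≡ wordSum n g +ℤ wordSum n h
wordSum-+ zero    g h = refl
wordSum-+ (suc n) g h =
  trans (cong₂ _+ℤ_ (wordSum-+ n (g ∘ (false ∷_)) (h ∘ (false ∷_))) (wordSum-+ n (g ∘ (true ∷_)) (h ∘ (true ∷_))))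
        (+-interchange (wordSum n (g ∘ (false ∷_))) (wordSum n (h ∘ (false ∷_)))
                       (wordSum n (g ∘ (true ∷_))) (wordSum n (h ∘ (true ∷_))))

wordSum-zero : ∀ n → wordSum n (λ _ → +0) ≡ +0
wordSum-zero zero    = refl
wordSum-zero (suc n) = cong₂ _+ℤ_ (wordSum-zero n) (wordSum-zero n)

wordSum-*ʳ : ∀ n c (g : List Bool → ℤ) → wordSum n g *ℤ c ≡ wordSum n (λ w → g w *ℤ c)
wordSum-*ʳ zero    c g = refl
wordSum-*ʳ (suc n) c g = trans (ℤ.*-distribʳ-+ c (wordSum n (g ∘ (false ∷_))) (wordSum n (g ∘ (true ∷_))))
                               (cong₂ _+ℤ_ (wordSum-*ʳ n c (g ∘ (false ∷_))) (wordSum-*ʳ n c (g ∘ (true ∷_))))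

sum-map-words : ∀ n (f : List Bool → ℕ) → + sum (map f (words n)) ≡ wordSum n (λ w → + f w)
sum-map-words zero    f = cong +_ (ℕ.+-identityʳ (f []))
sum-map-words (suc n) f = begin
  + sum (map f (map (false ∷_) (words n) ++ map (true ∷_) (words n)))
    ≡⟨ cong (+_ ∘ sum) (map-++ f (map (false ∷_) (words n)) (map (true ∷_) (words n))) ⟩
  + sum (map f (map (false ∷_) (words n)) ++ map f (map (true ∷_) (words n)))
    ≡⟨ cong +_ (sum-++ (map f (map (false ∷_) (words n))) (map f (map (true ∷_) (words n)))) ⟩
  + sum (map f (map (false ∷_) (words n))) +ℤ + sum (map f (map (true ∷_) (words n)))
    ≡⟨ cong₂ (λ xs ys → + sum xs +ℤ + sum ys) (sym (map-∘ (words n))) (sym (map-∘ (words n))) ⟩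
  + sum (map (f ∘ (false ∷_)) (words n)) +ℤ + sum (map (f ∘ (true ∷_)) (words n))
    ≡⟨ cong₂ _+ℤ_ (sum-map-words n (f ∘ (false ∷_))) (sum-map-words n (f ∘ (true ∷_))) ⟩
  wordSum (suc n) (λ w → + f w) ∎
  where open ≡-Reasoning

sum-map-filter : ∀ (b : List Bool → Bool) (f : List Bool → ℕ) ws →
  sum (map f (filter (λ w → T? (b w)) ws)) ≡ sum (map (λ w → if b w then f w else 0) ws)
sum-map-filter b f []       = refl
sum-map-filter b f (w ∷ ws) with b w
... | true  = cong (_+_ (f w)) (sum-map-filter b f ws)
... | false = sum-map-filter b f ws

acceptSum : ℕ → (List Bool → Bool) → (List Bool → ℤ) → ℤ
acceptSum n f ω = wordSum n (λ w → if f w then ω w else +0)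

sum-map-acceptedWords : ∀ (b : List Bool → Bool) (f : List Bool → ℕ) n →
  + sum (map f (filter (λ w → T? (b w)) (words n))) ≡ acceptSum n b (λ w → + f w)
sum-map-acceptedWords b f n = begin
  + sum (map f (filter (λ w → T? (b w)) (words n)))        ≡⟨ cong +_ (sum-map-filter b f (words n)) ⟩
  + sum (map (λ w → if b w then f w else 0) (words n))     ≡⟨ sum-map-words n _ ⟩
  wordSum n (λ w → + (if b w then f w else 0))             ≡⟨ wordSum-ext n (λ w → +-if (b w)) ⟩
  acceptSum n b (λ w → + f w)                              ∎
  where
  open ≡-Reasoning
  +-if : ∀ {m} b → + (if b then m else 0) ≡ (if b then + m else +0)
  +-if true  = refl
  +-if false = refl

acceptSum-+ : ∀ n f (ω ω′ : List Bool → ℤ) →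
  acceptSum n f (λ w → ω w +ℤ ω′ w) ≡ acceptSum n f ω +ℤ acceptSum n f ω′
acceptSum-+ n f ω ω′ = trans (wordSum-ext n (λ w → if-+ (f w))) (wordSum-+ n _ _)
  where
  if-+ : ∀ {w} b → (if b then ω w +ℤ ω′ w else +0) ≡ (if b then ω w else +0) +ℤ (if b then ω′ w else +0)
  if-+ true  = refl
  if-+ false = refl

acceptSum-∧ : ∀ n b f ω → acceptSum n (λ w → b ∧ f w) ω ≡ (if b then acceptSum n f ω else +0)
acceptSum-∧ n true  f ω = refl
acceptSum-∧ n false f ω = wordSum-zero n

acceptSum-length : ∀ n f → acceptSum n f (λ w → + length w) ≡ acceptSum n f (λ _ → + 1) *ℤ + n
acceptSum-length n f = begin
  acceptSum n f (λ w → + length w)                   ≡⟨ wordSum-cong n (λ w |w|≡n → if-length {w} (f w) |w|≡n) ⟩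
  wordSum n (λ w → (if f w then + 1 else +0) *ℤ + n) ≡⟨ sym (wordSum-*ʳ n (+ n) _) ⟩
  acceptSum n f (λ _ → + 1) *ℤ + n                   ∎
  where
  open ≡-Reasoning
  if-length : ∀ {w : List Bool} b → length w ≡ n →
              (if b then + length w else +0) ≡ (if b then + 1 else +0) *ℤ + n
  if-length true  |w|≡n = trans (cong +_ |w|≡n) (sym (ℤ.*-identityˡ (+ n)))
  if-length false _     = refl

-- The q-decreasing automaton

data Budget (b n : ℕ) : Set where
  exhausted : (b <ᵇ n) ≡ false → n ∸ b ≡ 0 → n ∸ suc b ≡ 0 → Budget b n
  remaining : ∀ r → (b <ᵇ n) ≡ true → n ∸ b ≡ suc r → n ∸ suc b ≡ r → Budget b n

budget : ∀ b n → Budget b n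
budget b       zero    = exhausted refl (ℕ.0∸n≡0 b) (ℕ.0∸n≡0 (suc b))
budget zero    (suc n) = remaining n refl refl refl
budget (suc b) (suc n) with budget b n
... | exhausted b≮n n∸b≡0 n∸1+b≡0   = exhausted b≮n n∸b≡0 n∸1+b≡0
... | remaining r b<n n∸b≡1+r n∸1+b≡r = remaining r b<n n∸b≡1+r n∸1+b≡r

ones+zeros : ∀ w → ones w + zeros w ≡ length w
ones+zeros []          = refl
ones+zeros (true ∷ w)  = cong suc (ones+zeros w)
ones+zeros (false ∷ w) = trans (ℕ.+-suc (ones w) (zeros w)) (cong suc (ones+zeros w))

-- Writing q = suc k makes q * suc a a successor by computation, which the
-- empty-word cases of the closed forms below rely on.
module Counts (k : ℕ) where
  q : ℕ
  q = suc k

  module Weighted (ω : List Bool → ℤ) (ω-1∷ : ∀ w → ω (true ∷ w) ≡ ω w) where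
    total : ℕ → ℤ
    total n = acceptSum n (qdec q) ω

    acceptSum-1∷ : ∀ n f → wordSum n (λ w → if f w then ω (true ∷ w) else +0) ≡ acceptSum n f ω
    acceptSum-1∷ n f = wordSum-ext n (λ w → cong (λ v → if f w then v else +0) (ω-1∷ w))

    total-suc : ∀ n → total (suc n) ≡ acceptSum n (inZeros q 1) (ω ∘ (false ∷_)) +ℤ total n
    total-suc n = cong (acceptSum n (inZeros q 1) (ω ∘ (false ∷_)) +ℤ_) (acceptSum-1∷ n (qdec q))

    inOnes-sum : ∀ n a b → acceptSum n (inOnes q a b) ω ≡ total n -ℤ shift (q * a ∸ b) total n
    inOnes-sum zero a b = base (budget b (q * a))
      where
      base : Budget b (q * a) →
             (if b <ᵇ q * a then ω [] else +0) ≡ ω [] -ℤ shift (q * a ∸ b) total 0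
      base (exhausted b≮qa qa∸b≡0 _) rewrite b≮qa | qa∸b≡0 = sym (ℤ.+-inverseʳ (ω []))
      base (remaining r b<qa qa∸b≡1+r _) rewrite b<qa | qa∸b≡1+r = sym (ℤ.+-identityʳ (ω []))
    inOnes-sum (suc n) a b = begin
      acceptSum (suc n) (inOnes q a b) ω
        ≡⟨ cong₂ _+ℤ_ (acceptSum-∧ n (b <ᵇ q * a) (inZeros q 1) (ω ∘ (false ∷_))) (acceptSum-1∷ n (inOnes q a (suc b))) ⟩
      (if b <ᵇ q * a then Z₁ else +0) +ℤ acceptSum n (inOnes q a (suc b)) ω
        ≡⟨ cong ((if b <ᵇ q * a then Z₁ else +0) +ℤ_) (inOnes-sum n a (suc b)) ⟩
      (if b <ᵇ q * a then Z₁ else +0) +ℤ (total n -ℤ shift (q * a ∸ suc b) total n)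
        ≡⟨ step (budget b (q * a)) ⟩
      total (suc n) -ℤ shift (q * a ∸ b) total (suc n) ∎
      where
      open ≡-Reasoning
      Z₁ = acceptSum n (inZeros q 1) (ω ∘ (false ∷_))
      step : Budget b (q * a) →
             (if b <ᵇ q * a then Z₁ else +0) +ℤ (total n -ℤ shift (q * a ∸ suc b) total n)
             ≡ total (suc n) -ℤ shift (q * a ∸ b) total (suc n)
      step (exhausted b≮qa qa∸b≡0 qa∸1+b≡0) rewrite b≮qa | qa∸b≡0 | qa∸1+b≡0 =
        trans (ℤ.+-identityˡ _) (trans (ℤ.+-inverseʳ (total n)) (sym (ℤ.+-inverseʳ (total (suc n)))))
      step (remaining r b<qa qa∸b≡1+r qa∸1+b≡r) rewrite b<qa | qa∸b≡1+r | qa∸1+b≡r =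
        trans (sym (ℤ.+-assoc Z₁ (total n) _)) (cong (_-ℤ shift r total n) (sym (total-suc n)))

  open Weighted (λ _ → + 1) (λ _ → refl) public
    using () renaming (total to c; inOnes-sum to inOnes-count)
  open Weighted (λ w → + zeros w) (λ _ → refl) public
    using () renaming (total to z; inOnes-sum to inOnes-zeros)

  K : FPS
  K = runningSum (+ 1) c

  T : ℕ → FPS
  T = tails (λ a → shift (q * a) c)

  c₀ : ℕ → ℕ → ℤ
  c₀ a n = acceptSum n (inZeros q a) (λ _ → + 1)

  c₀-closed : ∀ a n → c₀ (suc a) n ≡ K n -ℤ T (suc a) n
  c₀-closed a zero    = refl
  c₀-closed a (suc n) = begin
    c₀ (suc (suc a)) n +ℤ acceptSum n (inOnes q (suc a) 1) (λ _ → + 1)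
      ≡⟨ cong₂ _+ℤ_ (c₀-closed (suc a) n) (inOnes-count n (suc a) 1) ⟩
    (K n -ℤ T (suc (suc a)) n) +ℤ (c n -ℤ shift (q * suc a ∸ 1) c n)
      ≡⟨ regroup (K n) (T (suc (suc a)) n) (c n) (shift (q * suc a ∸ 1) c n) ⟩
    K (suc n) -ℤ T (suc a) (suc n) ∎
    where
    open ≡-Reasoning
    regroup : ∀ κ t γ s → (κ -ℤ t) +ℤ (γ -ℤ s) ≡ (κ +ℤ γ) -ℤ (s +ℤ t)
    regroup = solve-∀

  KZ : FPS
  KZ = runningSum +0 (K ⊕ z)

  TZ : ℕ → FPS
  TZ = tails (λ a → shift (q * a) z ⊕ shift 1 (T (suc a)))

  z₀ : ℕ → ℕ → ℤ
  z₀ a n = acceptSum n (inZeros q a) (λ w → + zeros w)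

  z₀-closed : ∀ a n → z₀ (suc a) n ≡ KZ n -ℤ TZ (suc a) n
  z₀-closed a zero    = refl
  z₀-closed a (suc n) = begin
    acceptSum n (inZeros q (suc (suc a))) (λ w → + 1 +ℤ + zeros w) +ℤ acceptSum n (inOnes q (suc a) 1) (λ w → + zeros w)
      ≡⟨ cong₂ _+ℤ_ (acceptSum-+ n (inZeros q (suc (suc a))) _ _) (inOnes-zeros n (suc a) 1) ⟩
    (c₀ (suc (suc a)) n +ℤ z₀ (suc (suc a)) n) +ℤ (z n -ℤ shift (q * suc a ∸ 1) z n)
      ≡⟨ cong (_+ℤ (z n -ℤ shift (q * suc a ∸ 1) z n)) (cong₂ _+ℤ_ (c₀-closed (suc a) n) (z₀-closed (suc a) n)) ⟩
    ((K n -ℤ T (suc (suc a)) n) +ℤ (KZ n -ℤ TZ (suc (suc a)) n)) +ℤ (z n -ℤ shift (q * suc a ∸ 1) z n)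
      ≡⟨ regroup (K n) (T (suc (suc a)) n) (KZ n) (TZ (suc (suc a)) n) (z n) (shift (q * suc a ∸ 1) z n) ⟩
    KZ (suc n) -ℤ TZ (suc a) (suc n) ∎
    where
    open ≡-Reasoning
    regroup : ∀ κ t κz tz ζ s → ((κ -ℤ t) +ℤ (κz -ℤ tz)) +ℤ (ζ -ℤ s) ≡ (κz +ℤ (κ +ℤ ζ)) -ℤ ((s +ℤ t) +ℤ tz)
    regroup = solve-∀

  p≡θc-z : ∀ n → + p q n ≡ + n *ℤ c n -ℤ z n
  p≡θc-z n = begin
    + p q n               ≡⟨ sum-map-acceptedWords (qdec q) ones n ⟩
    o                     ≡⟨ add-sub o (z n) ⟩
    (o +ℤ z n) -ℤ z n     ≡⟨ cong (_-ℤ z n) ones-and-zeros ⟩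
    + n *ℤ c n -ℤ z n     ∎
    where
    open ≡-Reasoning
    o = acceptSum n (qdec q) (λ w → + ones w)
    add-sub : ∀ a b → a ≡ (a +ℤ b) -ℤ b
    add-sub = solve-∀
    ones-and-zeros : o +ℤ z n ≡ + n *ℤ c n
    ones-and-zeros = begin
      o +ℤ z n                                      ≡⟨ sym (acceptSum-+ n (qdec q) _ _) ⟩
      acceptSum n (qdec q) (λ w → + (ones w + zeros w))
        ≡⟨ wordSum-ext n (λ w → cong (λ m → if qdec q w then + m else +0) (ones+zeros w)) ⟩
      acceptSum n (qdec q) (λ w → + length w)       ≡⟨ acceptSum-length n (qdec q) ⟩
      c n *ℤ + n                                    ≡⟨ ℤ.*-comm (c n) (+ n) ⟩
      + n *ℤ c n                                    ∎

-- Generating functions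

module Series (k : ℕ) where
  open Counts k
  open CommutativeRing ⊕-⊛-commutativeRing using (ring; +-cong; *-cong; -‿cong)
    renaming (refl to ≈-refl; sym to ≈-sym; trans to ≈-trans)
  open Null ring
  open FPSSolver using (solve; _:=_; con; _:+_; _:-_; :-_; _:*_)

  x y : FPS
  x = mono (+ 1) 1
  y = mono (+ 1) q

  y⊛≐shift : ∀ f → y ⊛ f ≐ shift (q * 1) f
  y⊛≐shift f n = trans (x^-⊛ q f n) (shift-index (sym (ℕ.*-identityʳ q)) f n)

  shift-q*suc : ∀ a f → shift (q * suc a) f ≐ shift q (shift (q * a) f)
  shift-q*suc a f n = trans (shift-index (trans (ℕ.*-suc q a) (ℕ.+-comm q (q * a))) f n) (sym (shift-shift q (q * a) f n))

  T-shift : ∀ a → T (suc a) ≐ shift q (T a)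
  T-shift = tails-shift q _ (λ a → shift-q*suc a c)

  TZ-shift : ∀ a → TZ (suc a) ≐ shift q (TZ a)
  TZ-shift = tails-shift q _ H-shift
    where
    H-shift : ∀ a → shift (q * suc a) z ⊕ shift 1 (T (suc (suc a))) ≐ shift q (shift (q * a) z ⊕ shift 1 (T (suc a)))
    H-shift a n = begin
      shift (q * suc a) z n +ℤ shift 1 (T (suc (suc a))) n
        ≡⟨ cong₂ _+ℤ_ (shift-q*suc a z n) (shift-cong 1 (T-shift (suc a)) n) ⟩
      shift q (shift (q * a) z) n +ℤ shift 1 (shift q (T (suc a))) n
        ≡⟨ cong (shift q (shift (q * a) z) n +ℤ_) (shift-comm 1 q (T (suc a)) n) ⟩
      shift q (shift (q * a) z) n +ℤ shift q (shift 1 (T (suc a))) n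
        ≡⟨ sym (shift-⊕ q _ _ n) ⟩
      shift q (shift (q * a) z ⊕ shift 1 (T (suc a))) n ∎
      where open ≡-Reasoning

  c-rec : c ≈ 𝟙 ⊕ x ⊛ ((K ⊕ ⊝ T 1) ⊕ c)
  c-rec = ≐⊕shift⇒≈⊕x⊛ 𝟙 ((K ⊕ ⊝ T 1) ⊕ c) λ
    { zero    → refl
    ; (suc n) → trans (cong (_+ℤ c n) (c₀-closed 0 n)) (sym (ℤ.+-identityˡ _))
    }

  K-rec : K ≈ 𝟙 ⊕ x ⊛ (K ⊕ c)
  K-rec = ≐⊕shift⇒≈⊕x⊛ 𝟙 (K ⊕ c) (runningSum-unfold (+ 1) c)

  T₁-rec : T 1 ≈ y ⊛ c ⊕ x ⊛ T 2
  T₁-rec = ≐⊕shift⇒≈⊕x⊛ (y ⊛ c) (T 2) λ n → trans (tails-unfold _ 1 n) (cong (_+ℤ shift 1 (T 2) n) (sym (y⊛≐shift c n)))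

  T₂-rec : T 2 ≈ y ⊛ T 1
  T₂-rec = coeffwise λ n → trans (T-shift 1 n) (sym (x^-⊛ q (T 1) n))

  z-rec : z ≈ x ⊛ (((K ⊕ ⊝ T 1) ⊕ (KZ ⊕ ⊝ TZ 1)) ⊕ z)
  z-rec = ≐shift⇒≈x⊛ (((K ⊕ ⊝ T 1) ⊕ (KZ ⊕ ⊝ TZ 1)) ⊕ z) λ
    { zero    → refl
    ; (suc n) → cong (_+ℤ z n) (trans (acceptSum-+ n (inZeros q 1) _ _)
                                      (cong₂ _+ℤ_ (c₀-closed 0 n) (z₀-closed 0 n)))
    }

  KZ-rec : KZ ≈ x ⊛ (KZ ⊕ (K ⊕ z))
  KZ-rec = ≐shift⇒≈x⊛ (KZ ⊕ (K ⊕ z)) λ { zero → refl ; (suc n) → refl }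

  TZ₁-rec : TZ 1 ≈ (y ⊛ z ⊕ x ⊛ T 2) ⊕ x ⊛ TZ 2
  TZ₁-rec = ≐⊕shift⇒≈⊕x⊛ (y ⊛ z ⊕ x ⊛ T 2) (TZ 2) λ n →
    trans (tails-unfold _ 1 n) (cong (_+ℤ shift 1 (TZ 2) n) (sym (cong₂ _+ℤ_ (y⊛≐shift z n) (x^-⊛ 1 (T 2) n))))

  TZ₂-rec : TZ 2 ≈ y ⊛ TZ 1
  TZ₂-rec = coeffwise λ n → trans (TZ-shift 1 n) (sym (x^-⊛ q (TZ 1) n))

  p-rec : ser (p q) ≈ θ c ⊕ ⊝ z
  p-rec = coeffwise p≡θc-z

  p′-rec : ser (p′ q) ≈ z
  p′-rec = coeffwise (sum-map-acceptedWords (qdec q) zeros)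

  u B : FPS
  u = 𝟙 ⊕ ⊝ (x ⊛ y)
  B = 𝟙 ⊕ ⊝ (x ⊕ x) ⊕ x ⊛ x ⊛ y

  u⊛T₁≈y⊛c : u ⊛ T 1 ≈ y ⊛ c
  u⊛T₁≈y⊛c = ≈+null⇒≈ (certificate x y c (T 1) (T 2))
    (null-+ (≈⇒null-diff T₁-rec) (null-*ˡ x (≈⇒null-diff T₂-rec)))
    where
    certificate = solve 5 (λ x y C T₁ T₂ →
      (con (+ 1) :- x :* y) :* T₁ := y :* C :+ ((T₁ :- (y :* C :+ x :* T₂)) :+ x :* (T₂ :- y :* T₁)))
      ≈-refl

  B⊛c≈u : B ⊛ c ≈ u
  B⊛c≈u = ≈+null⇒≈ (certificate x y c K (T 1))
    (null-+ (null-+ (null-*ˡ ((𝟙 ⊕ ⊝ x) ⊛ u) (≈⇒null-diff c-rec)) (null-*ˡ (x ⊛ u) (≈⇒null-diff K-rec)))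
            (null-*ˡ (x ⊛ (x ⊕ ⊝ 𝟙)) (≈⇒null-diff u⊛T₁≈y⊛c)))
    where
    certificate = solve 5 (λ x y C K T₁ →
      let 1ᴾ = con (+ 1)
          uᴾ = 1ᴾ :- x :* y
      in (1ᴾ :- (x :+ x) :+ x :* x :* y) :* C
         := uᴾ :+ ((1ᴾ :- x) :* uᴾ :* (C :- (1ᴾ :+ x :* ((K :- T₁) :+ C)))
                 :+ x :* uᴾ :* (K :- (1ᴾ :+ x :* (K :+ C)))
                 :+ x :* (x :- 1ᴾ) :* (uᴾ :* T₁ :- y :* C)))
      ≈-refl

  B⊛K≈𝟙 : B ⊛ K ≈ 𝟙
  B⊛K≈𝟙 = null-diff⇒≈ (⊛≈𝟘⇒≈𝟘 (𝟙 ⊕ ⊝ x) _ refl (≈-trans (certificate x y c K)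
    (null-+ (null-*ˡ B (≈⇒null-diff K-rec)) (null-*ˡ x (≈⇒null-diff B⊛c≈u)))))
    where
    certificate = solve 4 (λ x y C K →
      let 1ᴾ = con (+ 1)
          Bᴾ = 1ᴾ :- (x :+ x) :+ x :* x :* y
      in (1ᴾ :- x) :* (Bᴾ :* K :- 1ᴾ)
         := Bᴾ :* (K :- (1ᴾ :+ x :* (K :+ C))) :+ x :* (Bᴾ :* C :- (1ᴾ :- x :* y)))
      ≈-refl

  c≈u⊛K : c ≈ u ⊛ K
  c≈u⊛K = null-diff⇒≈ (⊛≈𝟘⇒≈𝟘 B _ refl (≈-trans (certificate x y c K)
    (null-+ (≈⇒null-diff B⊛c≈u) (null-*ˡ (⊝ u) (≈⇒null-diff B⊛K≈𝟙)))))
    where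
    certificate = solve 4 (λ x y C K →
      let 1ᴾ = con (+ 1)
          uᴾ = 1ᴾ :- x :* y
          Bᴾ = 1ᴾ :- (x :+ x) :+ x :* x :* y
      in Bᴾ :* (C :- uᴾ :* K) := (Bᴾ :* C :- uᴾ) :+ (:- uᴾ) :* (Bᴾ :* K :- 1ᴾ))
      ≈-refl

  T₁≈y⊛K : T 1 ≈ y ⊛ K
  T₁≈y⊛K = null-diff⇒≈ (⊛≈𝟘⇒≈𝟘 u _ refl (≈-trans (certificate x y c K (T 1))
    (null-+ (≈⇒null-diff u⊛T₁≈y⊛c) (null-*ˡ y (≈⇒null-diff c≈u⊛K)))))
    where
    certificate = solve 5 (λ x y C K T₁ →
      let uᴾ = con (+ 1) :- x :* y
      in uᴾ :* (T₁ :- y :* K) := (uᴾ :* T₁ :- y :* C) :+ y :* (C :- uᴾ :* K))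
      ≈-refl

  u⊛TZ₁ : u ⊛ TZ 1 ≈ y ⊛ z ⊕ x ⊛ y ⊛ y ⊛ K
  u⊛TZ₁ = ≈+null⇒≈ (certificate x y z K (T 1) (T 2) (TZ 1) (TZ 2))
    (null-+ (null-+ (null-+ (≈⇒null-diff TZ₁-rec) (null-*ˡ x (≈⇒null-diff TZ₂-rec)))
                    (null-*ˡ x (≈⇒null-diff T₂-rec)))
            (null-*ˡ (x ⊛ y) (≈⇒null-diff T₁≈y⊛K)))
    where
    certificate = solve 8 (λ x y Z K T₁ T₂ TZ₁ TZ₂ →
      (con (+ 1) :- x :* y) :* TZ₁
      := (y :* Z :+ x :* y :* y :* K)
         :+ ((TZ₁ :- ((y :* Z :+ x :* T₂) :+ x :* TZ₂)) :+ x :* (TZ₂ :- y :* TZ₁)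
             :+ x :* (T₂ :- y :* T₁) :+ x :* y :* (T₁ :- y :* K)))
      ≈-refl

  B⊛z : B ⊛ z ≈ x ⊛ (𝟙 ⊕ ⊝ y) ⊛ K
  B⊛z = ≈+null⇒≈ (certificate x y z K (T 1) KZ (TZ 1))
    (null-+ (null-+ (null-+ (null-*ˡ ((𝟙 ⊕ ⊝ x) ⊛ u) (≈⇒null-diff z-rec))
                            (null-*ˡ (x ⊛ (x ⊕ ⊝ 𝟙) ⊛ u) (≈⇒null-diff T₁≈y⊛K)))
                    (null-*ˡ (x ⊛ u) (≈⇒null-diff KZ-rec)))
            (null-*ˡ (x ⊛ (x ⊕ ⊝ 𝟙)) (≈⇒null-diff u⊛TZ₁)))
    where
    certificate = solve 7 (λ x y Z K T₁ KZ TZ₁ →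
      let 1ᴾ = con (+ 1)
          uᴾ = 1ᴾ :- x :* y
      in (1ᴾ :- (x :+ x) :+ x :* x :* y) :* Z
         := x :* (1ᴾ :- y) :* K
            :+ ((1ᴾ :- x) :* uᴾ :* (Z :- x :* (((K :- T₁) :+ (KZ :- TZ₁)) :+ Z))
                :+ x :* (x :- 1ᴾ) :* uᴾ :* (T₁ :- y :* K)
                :+ x :* uᴾ :* (KZ :- x :* (KZ :+ (K :+ Z)))
                :+ x :* (x :- 1ᴾ) :* (uᴾ :* TZ₁ :- (y :* Z :+ x :* y :* y :* K))))
      ≈-refl

  B⊛B⊛z : B ⊛ B ⊛ z ≈ x ⊛ (𝟙 ⊕ ⊝ y)
  B⊛B⊛z = ≈+null⇒≈ (certificate x y z K)
    (null-+ (null-*ˡ B (≈⇒null-diff B⊛z)) (null-*ˡ (x ⊛ (𝟙 ⊕ ⊝ y)) (≈⇒null-diff B⊛K≈𝟙)))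
    where
    certificate = solve 4 (λ x y Z K →
      let 1ᴾ = con (+ 1)
          Bᴾ = 1ᴾ :- (x :+ x) :+ x :* x :* y
      in Bᴾ :* Bᴾ :* Z := x :* (1ᴾ :- y)
                          :+ (Bᴾ :* (Bᴾ :* Z :- x :* (1ᴾ :- y) :* K) :+ x :* (1ᴾ :- y) :* (Bᴾ :* K :- 1ᴾ)))
      ≈-refl

  cq : FPS
  cq = mono (+ q) 0

  θ-x : θ x ≈ x
  θ-x = θ-mono (+ 1) 1

  θ-y : θ y ≈ cq ⊛ y
  θ-y = ≈-trans (θ-mono (+ 1) q) (≈-sym (mono-⊛-mono (+ q) (+ 1) 0 q))

  θ-B : θ B ≈ ⊝ (x ⊕ x) ⊕ (cq ⊕ 𝟙 ⊕ 𝟙) ⊛ x ⊛ x ⊛ y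
  θ-B = ≈-trans expand (≈+null⇒≈ (certificate x y cq (θ x) (θ y))
    (null-+ (null-+ (null-*ˡ (⊝ (𝟙 ⊕ 𝟙)) (≈⇒null-diff θ-x)) (null-*ˡ ((𝟙 ⊕ 𝟙) ⊛ x ⊛ y) (≈⇒null-diff θ-x)))
            (null-*ˡ (x ⊛ x) (≈⇒null-diff θ-y))))
    where
    expand : θ B ≈ mono +0 0 ⊕ ⊝ (θ x ⊕ θ x) ⊕ ((θ x ⊛ x ⊕ x ⊛ θ x) ⊛ y ⊕ x ⊛ x ⊛ θ y)
    expand = ≈-trans (θ-⊕ _ _) (+-cong (≈-trans (θ-⊕ _ _) (+-cong (θ-mono (+ 1) 0) (≈-trans (θ-⊝ _) (-‿cong (θ-⊕ x x)))))
                                       (≈-trans (θ-⊛ (x ⊛ x) y) (+-cong (*-cong (θ-⊛ x x) (≈-refl {y})) (≈-refl {x ⊛ x ⊛ θ y}))))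
    certificate = solve 5 (λ x y cq θx θy →
      let 1ᴾ = con (+ 1)
          2ᴾ = 1ᴾ :+ 1ᴾ
      in con +0 :- (θx :+ θx) :+ ((θx :* x :+ x :* θx) :* y :+ x :* x :* θy)
         := :- (x :+ x) :+ (cq :+ 1ᴾ :+ 1ᴾ) :* x :* x :* y
            :+ ((:- 2ᴾ) :* (θx :- x) :+ 2ᴾ :* x :* y :* (θx :- x) :+ x :* x :* (θy :- cq :* y)))
      ≈-refl

  θ-u : θ u ≈ ⊝ ((cq ⊕ 𝟙) ⊛ x ⊛ y)
  θ-u = ≈-trans expand (≈+null⇒≈ (certificate x y cq (θ x) (θ y))
    (null-+ (null-*ˡ (⊝ y) (≈⇒null-diff θ-x)) (null-*ˡ (⊝ x) (≈⇒null-diff θ-y))))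
    where
    expand : θ u ≈ mono +0 0 ⊕ ⊝ (θ x ⊛ y ⊕ x ⊛ θ y)
    expand = ≈-trans (θ-⊕ _ _) (+-cong (θ-mono (+ 1) 0) (≈-trans (θ-⊝ _) (-‿cong (θ-⊛ x y))))
    certificate = solve 5 (λ x y cq θx θy →
      con +0 :- (θx :* y :+ x :* θy)
      := :- ((cq :+ con (+ 1)) :* x :* y) :+ ((:- y) :* (θx :- x) :+ (:- x) :* (θy :- cq :* y)))
      ≈-refl

  B⊛B⊛p : B ⊛ B ⊛ ser (p q) ≈ x ⊛ (𝟙 ⊕ ⊝ (cq ⊛ y) ⊕ cq ⊛ y ⊛ x ⊕ ⊝ (y ⊛ x ⊕ y ⊛ x) ⊕ y ⊛ y ⊛ x ⊛ x)
  B⊛B⊛p = ≈+null⇒≈ (certificate x y cq c z (ser (p q)) (θ c) (θ B) (θ u))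
    (null-+ (null-+ (null-+ (null-+ (null-+
      (null-*ˡ (B ⊛ B) (≈⇒null-diff p-rec))
      (null-*ˡ B (≈⇒null-diff leibniz)))
      (null-*ˡ (⊝ θ B) (≈⇒null-diff B⊛c≈u)))
      (null-‿ (≈⇒null-diff B⊛B⊛z)))
      (null-*ˡ B (≈⇒null-diff θ-u)))
      (null-*ˡ (⊝ u) (≈⇒null-diff θ-B)))
    where
    leibniz : θ B ⊛ c ⊕ B ⊛ θ c ≈ θ u
    leibniz = ≈-trans (≈-sym (θ-⊛ B c)) (θ-cong B⊛c≈u)
    certificate = solve 9 (λ x y cq C Z P θC θB θu →
      let 1ᴾ = con (+ 1)
          uᴾ = 1ᴾ :- x :* y
          Bᴾ = 1ᴾ :- (x :+ x) :+ x :* x :* y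
          θBᴾ = :- (x :+ x) :+ (cq :+ 1ᴾ :+ 1ᴾ) :* x :* x :* y
          θuᴾ = :- ((cq :+ 1ᴾ) :* x :* y)
      in Bᴾ :* Bᴾ :* P
         := x :* (1ᴾ :- cq :* y :+ cq :* y :* x :- (y :* x :+ y :* x) :+ y :* y :* x :* x)
            :+ (Bᴾ :* Bᴾ :* (P :- (θC :- Z))
                :+ Bᴾ :* ((θB :* C :+ Bᴾ :* θC) :- θu)
                :+ (:- θB) :* (Bᴾ :* C :- uᴾ)
                :+ :- (Bᴾ :* Bᴾ :* Z :- x :* (1ᴾ :- y))
                :+ Bᴾ :* (θu :- θuᴾ)
                :+ (:- uᴾ) :* (θB :- θBᴾ)))
      ≈-refl

  B≈monomials : B ≈ mono (+ 1) 0 ⊕ mono (- (+ 2)) 1 ⊕ mono (+ 1) (q + 2)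
  B≈monomials = +-cong (+-cong (≈-refl {𝟙}) (≈-sym (≈-trans (mono-neg (+ 2) 1) (-‿cong (mono-+ (+ 1) (+ 1) 1)))))
                       (≈-trans (*-cong (x^⊛x^ 1 1) (≈-refl {y})) (≈-trans (x^⊛x^ 2 q) (mono-degree (+ 1) (ℕ.+-comm 2 q))))

  p-numerator : 𝟙 ⊕ ⊝ (cq ⊛ y) ⊕ cq ⊛ y ⊛ x ⊕ ⊝ (y ⊛ x ⊕ y ⊛ x) ⊕ y ⊛ y ⊛ x ⊛ x
                ≈ mono (+ 1) 0 ⊕ mono (- (+ q)) q ⊕ mono (+ q) (q + 1) ⊕ mono (- (+ 2)) (q + 1) ⊕ mono (+ 1) (2 * q + 2)
  p-numerator = +-cong (+-cong (+-cong (+-cong (≈-refl {𝟙}) qy) qyx) 2yx) yyxx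
    where
    qy : ⊝ (cq ⊛ y) ≈ mono (- (+ q)) q
    qy = ≈-trans (-‿cong (const⊛x^ (+ q) q)) (≈-sym (mono-neg (+ q) q))
    qyx : cq ⊛ y ⊛ x ≈ mono (+ q) (q + 1)
    qyx = ≈-trans (*-cong (const⊛x^ (+ q) q) (≈-refl {x}))
                  (≈-trans (mono-⊛-mono (+ q) (+ 1) q 1) (mono-coeff (q + 1) (ℤ.*-identityʳ (+ q))))
    2yx : ⊝ (y ⊛ x ⊕ y ⊛ x) ≈ mono (- (+ 2)) (q + 1)
    2yx = ≈-trans (-‿cong (≈-trans (+-cong (x^⊛x^ q 1) (x^⊛x^ q 1)) (≈-sym (mono-+ (+ 1) (+ 1) (q + 1)))))
                  (≈-sym (mono-neg (+ 2) (q + 1)))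
    yyxx : y ⊛ y ⊛ x ⊛ x ≈ mono (+ 1) (2 * q + 2)
    yyxx = ≈-trans (*-cong (≈-trans (*-cong (x^⊛x^ q q) (≈-refl {x})) (x^⊛x^ (q + q) 1)) (≈-refl {x}))
                   (≈-trans (x^⊛x^ (q + q + 1) 1) (mono-degree (+ 1) (exponent q)))
      where
      exponent : ∀ q → q + q + 1 + 1 ≡ 2 * q + 2
      exponent = ℕ-solve-∀

  p-generatingFunction : let B′ = mono (+ 1) 0 ⊕ mono (- (+ 2)) 1 ⊕ mono (+ 1) (q + 2) in
    (B′ ⊛ B′) ⊛ ser (p q) ≐ mono (+ 1) 1 ⊛ (mono (+ 1) 0 ⊕ mono (- (+ q)) q ⊕ mono (+ q) (q + 1)
                                           ⊕ mono (- (+ 2)) (q + 1) ⊕ mono (+ 1) (2 * q + 2))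
  p-generatingFunction = coeff (≈-trans (*-cong (*-cong (≈-sym B≈monomials) (≈-sym B≈monomials)) (≈-refl {ser (p q)}))
                                (≈-trans B⊛B⊛p (*-cong (≈-refl {x}) p-numerator)))

  p′-generatingFunction : let B′ = mono (+ 1) 0 ⊕ mono (- (+ 2)) 1 ⊕ mono (+ 1) (q + 2) in
    (B′ ⊛ B′) ⊛ ser (p′ q) ≐ mono (+ 1) 1 ⊛ (mono (+ 1) 0 ⊕ mono (- (+ 1)) q)
  p′-generatingFunction = coeff (≈-trans (*-cong (*-cong (≈-sym B≈monomials) (≈-sym B≈monomials)) p′-rec)
                                 (≈-trans B⊛B⊛z (*-cong (≈-refl {x}) (+-cong (≈-refl {𝟙}) (≈-sym (mono-neg (+ 1) q))))))

corollary3 : (q : ℕ) → 1 ≤ q →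
  let B = mono (+ 1) 0 ⊕ mono (- (+ 2)) 1 ⊕ mono (+ 1) (q + 2)
      D = B ⊛ B
  in (D ⊛ ser (p q)
        ≐ mono (+ 1) 1 ⊛ (mono (+ 1) 0 ⊕ mono (- (+ q)) q ⊕ mono (+ q) (q + 1)
                           ⊕ mono (- (+ 2)) (q + 1) ⊕ mono (+ 1) (2 * q + 2)))
   × (D ⊛ ser (p′ q)
        ≐ mono (+ 1) 1 ⊛ (mono (+ 1) 0 ⊕ mono (- (+ 1)) q))
corollary3 (suc k) (s≤s z≤n) = Series.p-generatingFunction k , Series.p′-generatingFunction k
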